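{- Let $k$ be an infinite field with $\mathrm{char}(k)\neq 2,3$, and let $V_2$ be a $2$-dimensional $k$-vector space with basis $\{e_1,e_2\}$. Let $\omega=\otimes_{1\le i<j<k\le 6}(v_{i,j,k})\in V_2^{\otimes 20}$ with every $v_{i,j,k}\in\{e_1,e_2\}$. If at least $11$ of the entries $v_{i,j,k}$ are equal to $e_1$, then $\hat\omega=0$ in $\Lambda^{S^3}_{V_2}[6]$.
   Context: For a $k$-vector space $V$ and $n\ge 0$, $\mathcal{T}^{S^3}_V[n]=V^{\otimes\binom{n}{3}}$, with tensor factors indexed by the triples $(i,j,k)$, $1\le i<j<k\le n$; simple tensors are written $\otimes_{1\le i<j<k\le n}(v_{i,j,k})$. $\mathcal{E}^{S^3}_V[n]$ is the subspace spanned by all simple tensors for which there exist $1\le x<y<z<t\le n$ with $v_{x,y,z}=v_{x,y,t}=v_{x,z,t}=v_{y,z,t}$. Define $\Lambda^{S^3}_V[n]=\mathcal{T}^{S^3}_V[n]/\mathcal{E}^{S^3}_V[n]$, and let $\hat\omega$ be the image of $\omega$ in $\Lambda^{S^3}_V[n]$. -}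

module Defs where

open import Level using (Level; _⊔_)
open import Algebra.Bundles using (CommutativeRing)
open import Data.Nat as ℕ using (ℕ; _≤_)
open import Data.Fin as Fin using (Fin; _<_; _≟_)
open import Data.Fin.Properties using (_<?_)
open import Data.List using (List; []; _∷_; length; filter; concatMap; allFin)
open import Data.List.Relation.Unary.All using (All)
open import Data.Vec using (Vec; []; _∷_)
open import Data.Product using (Σ; ∃; _×_; _,_)
open import Relation.Nullary using (¬_; Dec; yes; no)
open import Relation.Nullary.Decidable using (_×-dec_)

Triple : ℕ → Set
Triple n = Fin n × Fin n × Fin n

-- The list of all triples 1 ≤ i < j < k ≤ n (0-based here), in lexicographic order.
triples : (n : ℕ) → List (Triple n)
triples n = filter (λ { (i , j , k) → (i <? j) ×-dec (j <? k) })
  (concatMap (λ i → concatMap (λ j → Data.List.map (λ k → (i , j , k)) (allFin n)) (allFin n)) (allFin n))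

N : ℕ → ℕ
N n = length (triples n)

-- Basis words of V₂^{⊗ binom(n,3)} (V₂ = k² with basis e₁ = index 0, e₂ = index 1).
Word : ℕ → Set
Word n = Vec (Fin 2) (N n)

module _ {c ℓ : Level} (R : CommutativeRing c ℓ) where
  open CommutativeRing R

  IsField : Set (c ⊔ ℓ)
  IsField = (¬ (0# ≈ 1#)) × (∀ x → ¬ (x ≈ 0#) → ∃ λ y → x * y ≈ 1#)

  Infinite : Set (c ⊔ ℓ)
  Infinite = (xs : List Carrier) → ∃ λ x → All (λ y → ¬ (x ≈ y)) xs

  CharNot2 : Set ℓ
  CharNot2 = ¬ ((1# + 1#) ≈ 0#)

  CharNot3 : Set ℓ
  CharNot3 = ¬ ((1# + 1# + 1#) ≈ 0#)

  -- Vectors of V₂ = k², in coordinates w.r.t. the basis {e₁, e₂}.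
  V₂ : Set c
  V₂ = Fin 2 → Carrier

  _≈V_ : V₂ → V₂ → Set ℓ
  v ≈V u = ∀ d → v d ≈ u d

  -- basis vector e_{b} (b = 0 ↦ e₁, b = 1 ↦ e₂)
  e : Fin 2 → V₂
  e b d with b ≟ d
  ... | yes _ = 1#
  ... | no _ = 0#

  -- T^{S^3}_{V₂}[n] = V₂^{⊗ binom(n,3)}, as coefficient functions on basis words.
  Tensor : ℕ → Set c
  Tensor n = Word n → Carrier

  -- A family (v_{i,j,k}) of vectors (only the values at i<j<k matter).
  Family : ℕ → Set c
  Family n = Fin n → Fin n → Fin n → V₂

  prodOver : {n : ℕ} → Family n → (ts : List (Triple n)) → Vec (Fin 2) (length ts) → Carrier
  prodOver v [] [] = 1#
  prodOver v ((i , j , k) ∷ ts) (b ∷ bs) = v i j k b * prodOver v ts bs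

  simple : {n : ℕ} → Family n → Tensor n
  simple {n} v w = prodOver v (triples n) w

  -- the generating condition of E^{S^3}_{V₂}[n]:
  -- ∃ x<y<z<t with v_{x,y,z} = v_{x,y,t} = v_{x,z,t} = v_{y,z,t}
  Degenerate : {n : ℕ} → Family n → Set ℓ
  Degenerate {n} v = Σ (Fin n) λ x → Σ (Fin n) λ y → Σ (Fin n) λ z → Σ (Fin n) λ t →
    (x < y) × (y < z) × (z < t) ×
    (v x y z ≈V v x y t) × (v x y t ≈V v x z t) × (v x z t ≈V v y z t)

  Generator : ℕ → Set (c ⊔ ℓ)
  Generator n = Carrier × Σ (Family n) Degenerate

  combo : {n : ℕ} → List (Generator n) → Tensor n
  combo [] w = 0#
  combo ((a , v , _) ∷ gs) w = a * simple v w + combo gs w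

  -- ω ∈ E^{S^3}_{V₂}[n], i.e. ω̂ = 0 in Λ^{S^3}_{V₂}[n] = T / E
  VanishesInΛ : (n : ℕ) → Tensor n → Set (c ⊔ ℓ)
  VanishesInΛ n ω = Σ (List (Generator n)) λ gs → ∀ (w : Word n) → ω w ≈ combo gs w

  basisTensor : (n : ℕ) → (Fin n → Fin n → Fin n → Fin 2) → Tensor n
  basisTensor n b = simple (λ i j k → e (b i j k))

countE₁ : {n : ℕ} → (Fin n → Fin n → Fin n → Fin 2) → ℕ
countE₁ {n} b = length (filter (λ { (i , j , k) → b i j k ≟ Fin.zero }) (triples n))

{-# OPTIONS --safe #-}
-- Substituting one vector u = a e₁ + b e₂ into the four faces of a quadruple x < y < z < t
-- gives a generator of E; expanding it, Σₖ aᵏ b⁴⁻ᵏ Oₖ ∈ E, where Oₖ sums the basis words that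
-- agree with β off those faces and carry k letters e₁ on them. Five choices of (a , b) and
-- division by 6 put every Oₖ in E, so β vanishes once its other same-weight variants on one
-- quadruple do. Checked exhaustively on K₅, this shows that a word with seven equal letters on
-- some K₅ ⊆ K₆ vanishes. For a word with at least 11 letters e₁, a pruned search over K₆ finds
-- either such a K₅ or a quadruple each of whose variants moves a letter onto a face whose
-- opposite vertex already sees six copies of it, which creates such a K₅.
module Submission where

open import Defs
open import Algebra.Bundles using (CommutativeRing)
open import Data.Fin using (Fin)
open import Data.Nat using (_≤_)
open import Data.Product using (proj₂)
open import Level using (Level)
import Relation.Binary.PropositionalEquality as ≡

module Words where

  open import Data.Bool using (Bool; true; false; if_then_else_; not)
  open import Data.Empty using (⊥-elim)
  open import Data.Fin using (zero; suc)
  open import Data.Fin.Patterns using (0F; 1F)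
  open import Data.Fin.Properties using (all?; any?) renaming (_≟_ to _≟ᶠ_)
  open import Data.List using (List; []; _∷_; _++_; filterᵇ)
  import Data.List as List
  open import Data.List.Membership.Propositional using (_∈_)
  open import Data.List.Membership.Propositional.Properties using (∈-map⁺; ∈-++⁺ˡ; ∈-++⁺ʳ)
  open import Data.List.Relation.Unary.All as ListAll using ()
  open import Data.List.Relation.Unary.Any using (here)
  open import Data.Nat using (ℕ; zero; suc; _+_; _*_)
  open import Data.Nat.ListAction using (sum)
  open import Data.Nat.Properties using (_≟_; +-assoc; +-suc; +-identityʳ; +-commutativeSemigroup)
  open import Algebra.Properties.CommutativeSemigroup +-commutativeSemigroup using (x∙yz≈xz∙y; xy∙z≈xz∙y; xy∙z≈zy∙x)
  open import Data.Product using (∃; _×_; _,_; proj₁; proj₂)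
  open import Data.Vec using (Vec; []; _∷_; lookup; map; replicate; _[_]≔_; fromList)
  open import Data.Vec.Properties
    using (lookup∘update; lookup∘update′; []≔-commutes; []≔-idempotent; []≔-lookup; map-[]≔; ≡-dec)
  open import Data.Vec.Relation.Unary.All using (All; []; _∷_)
  open import Data.Vec.Relation.Unary.AllPairs using ([]; _∷_)
  open import Data.Vec.Relation.Unary.Unique.Propositional using (Unique)
  open import Relation.Nullary using (does; ¬?; _×-dec_)
  open import Relation.Nullary.Decidable using (from-yes)
  open import Relation.Binary.PropositionalEquality
    using (_≡_; _≢_; refl; sym; trans; cong; cong₂; module ≡-Reasoning)

  private
    variable
      a b : Level
      A : Set a
      B : Set b
      k m : ℕ

  fill : Vec (Fin m) k → Vec A k → Vec A m → Vec A m
  fill []       []       xs = xs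
  fill (p ∷ ps) (y ∷ ys) xs = fill ps ys (xs [ p ]≔ y)

  select : Vec (Fin m) k → Vec A m → Vec A k
  select ps xs = map (lookup xs) ps

  lookup-fill : ∀ {p} {ps : Vec (Fin m) k} → All (p ≢_) ps →
    ∀ (ys : Vec A k) xs → lookup (fill ps ys xs) p ≡ lookup xs p
  lookup-fill []           []       xs = refl
  lookup-fill (p≢q ∷ p∉ps) (y ∷ ys) xs = trans (lookup-fill p∉ps ys _) (lookup∘update′ p≢q xs y)

  fill-[]≔ : ∀ {p} {ps : Vec (Fin m) k} → All (p ≢_) ps →
    ∀ (ys : Vec A k) xs x → fill ps ys (xs [ p ]≔ x) ≡ fill ps ys xs [ p ]≔ x
  fill-[]≔                []           []       xs x = refl
  fill-[]≔ {ps = q ∷ ps} (p≢q ∷ p∉ps) (y ∷ ys) xs x =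
    trans (cong (fill ps ys) ([]≔-commutes xs _ q p≢q)) (fill-[]≔ p∉ps ys _ x)

  select-[]≔ : ∀ {p} {ps : Vec (Fin m) k} → All (p ≢_) ps →
    ∀ (xs : Vec A m) x → select ps (xs [ p ]≔ x) ≡ select ps xs
  select-[]≔ []           xs x = refl
  select-[]≔ (p≢q ∷ p∉ps) xs x =
    cong₂ _∷_ (lookup∘update′ (λ q≡p → p≢q (sym q≡p)) xs x) (select-[]≔ p∉ps xs x)

  select-fill : ∀ {ps : Vec (Fin m) k} → Unique ps → ∀ (ys : Vec A k) xs → select ps (fill ps ys xs) ≡ ys
  select-fill []              []       xs = refl
  select-fill (p∉ps ∷ unique) (y ∷ ys) xs =
    cong₂ _∷_ (trans (lookup-fill p∉ps ys _) (lookup∘update _ xs y)) (select-fill unique ys _)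

  fill-fill : ∀ {ps : Vec (Fin m) k} → Unique ps →
    ∀ (ys zs : Vec A k) xs → fill ps ys (fill ps zs xs) ≡ fill ps ys xs
  fill-fill                []              []       []       xs = refl
  fill-fill {ps = p ∷ ps} (p∉ps ∷ unique) (y ∷ ys) (z ∷ zs) xs = begin
    fill ps ys (fill ps zs (xs [ p ]≔ z) [ p ]≔ y)  ≡⟨ cong (fill ps ys) (fill-[]≔ p∉ps zs _ y) ⟨
    fill ps ys (fill ps zs (xs [ p ]≔ z [ p ]≔ y))  ≡⟨ fill-fill unique ys zs _ ⟩
    fill ps ys (xs [ p ]≔ z [ p ]≔ y)               ≡⟨ cong (fill ps ys) ([]≔-idempotent xs p) ⟩
    fill ps ys (xs [ p ]≔ y)                         ∎
    where open ≡-Reasoning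

  fill-select : ∀ (ps : Vec (Fin m) k) (xs : Vec A m) → fill ps (select ps xs) xs ≡ xs
  fill-select []       xs = refl
  fill-select (p ∷ ps) xs = trans (cong (fill ps (select ps xs)) ([]≔-lookup xs p)) (fill-select ps xs)

  map-fill : ∀ (f : A → B) (ps : Vec (Fin m) k) ys xs → map f (fill ps ys xs) ≡ fill ps (map f ys) (map f xs)
  map-fill f []       []       xs = refl
  map-fill f (p ∷ ps) (y ∷ ys) xs = trans (map-fill f ps ys _) (cong (fill ps (map f ys)) (map-[]≔ f xs p))

  map-≡-lookup : ∀ {f : A → B} {xs : Vec A k} {ys} → (∀ p → f (lookup xs p) ≡ lookup ys p) → map f xs ≡ ys
  map-≡-lookup {xs = []}     {[]}     eq = refl
  map-≡-lookup {xs = x ∷ xs} {y ∷ ys} eq = cong₂ _∷_ (eq zero) (map-≡-lookup (λ p → eq (suc p)))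

  extensions : List (Vec (Fin 2) k) → List (Vec (Fin 2) (suc k))
  extensions ws = List.map (0F ∷_) ws ++ List.map (1F ∷_) ws

  ∈-extensions : ∀ {y} {ws : List (Vec (Fin 2) k)} x → y ∈ ws → (x ∷ y) ∈ extensions ws
  ∈-extensions 0F y∈ws = ∈-++⁺ˡ (∈-map⁺ (0F ∷_) y∈ws)
  ∈-extensions 1F y∈ws = ∈-++⁺ʳ _ (∈-map⁺ (1F ∷_) y∈ws)

  allWords : ∀ k → List (Vec (Fin 2) k)
  allWords zero    = [] ∷ []
  allWords (suc k) = extensions (allWords k)

  ∈-allWords : ∀ (y : Vec (Fin 2) k) → y ∈ allWords k
  ∈-allWords []      = here refl
  ∈-allWords (x ∷ y) = ∈-extensions x (∈-allWords y)

  enumerateOn : Vec Bool k → Vec (Fin 2) k → List (Vec (Fin 2) k)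
  enumerateOn []           []       = [] ∷ []
  enumerateOn (true  ∷ ms) (_ ∷ xs) = extensions (enumerateOn ms xs)
  enumerateOn (false ∷ ms) (x ∷ xs) = List.map (x ∷_) (enumerateOn ms xs)

  ∈-enumerateOn : ∀ (ms : Vec Bool k) xs → xs ∈ enumerateOn ms xs
  ∈-enumerateOn []           []       = here refl
  ∈-enumerateOn (true  ∷ ms) (x ∷ xs) = ∈-extensions x (∈-enumerateOn ms xs)
  ∈-enumerateOn (false ∷ ms) (x ∷ xs) = ∈-map⁺ (x ∷_) (∈-enumerateOn ms xs)

  occurs : Fin 2 → Fin 2 → ℕ
  occurs 0F 0F = 1
  occurs 1F 1F = 1
  occurs _  _  = 0

  occurs-refl : ∀ b → occurs b b ≡ 1
  occurs-refl 0F = refl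
  occurs-refl 1F = refl

  occurs-≢ : ∀ {b d} → b ≢ d → occurs b d ≡ 0
  occurs-≢ {0F} {0F} b≢d = ⊥-elim (b≢d refl)
  occurs-≢ {0F} {1F} _   = refl
  occurs-≢ {1F} {0F} _   = refl
  occurs-≢ {1F} {1F} b≢d = ⊥-elim (b≢d refl)

  occursIf : Bool → Fin 2 → Fin 2 → ℕ
  occursIf m b x = if m then occurs b x else 0

  countOn : Vec Bool k → Fin 2 → Vec (Fin 2) k → ℕ
  countOn []       b []       = 0
  countOn (m ∷ ms) b (x ∷ xs) = occursIf m b x + countOn ms b xs

  count : Fin 2 → Vec (Fin 2) k → ℕ
  count = countOn (replicate _ true)

  count0F+count1F≡length : ∀ (xs : Vec (Fin 2) k) → count 0F xs + count 1F xs ≡ k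
  count0F+count1F≡length []        = refl
  count0F+count1F≡length (0F ∷ xs) = cong suc (count0F+count1F≡length xs)
  count0F+count1F≡length (1F ∷ xs) =
    trans (+-suc (count 0F xs) (count 1F xs)) (cong suc (count0F+count1F≡length xs))

  count-filter : ∀ (f : A → Fin 2) (ts : List A) →
    List.length (List.filter (λ t → f t ≟ᶠ 0F) ts) ≡ count 0F (map f (fromList ts))
  count-filter f []       = refl
  count-filter f (t ∷ ts) with f t
  ... | 0F = cong suc (count-filter f ts)
  ... | 1F = count-filter f ts

  countOn-[]≔ : ∀ (ms : Vec Bool m) b xs p y →
    countOn ms b (xs [ p ]≔ y) + occursIf (lookup ms p) b (lookup xs p) ≡
    countOn ms b xs + occursIf (lookup ms p) b y
  countOn-[]≔ (m ∷ ms) b (x ∷ xs) zero    y = xy∙z≈zy∙x (occursIf m b y) (countOn ms b xs) (occursIf m b x)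
  countOn-[]≔ (m ∷ ms) b (x ∷ xs) (suc p) y = begin
    occursIf m b x + countOn ms b (xs [ p ]≔ y) + occursIf (lookup ms p) b (lookup xs p)
      ≡⟨ +-assoc (occursIf m b x) _ _ ⟩
    occursIf m b x + (countOn ms b (xs [ p ]≔ y) + occursIf (lookup ms p) b (lookup xs p))
      ≡⟨ cong (occursIf m b x +_) (countOn-[]≔ ms b xs p y) ⟩
    occursIf m b x + (countOn ms b xs + occursIf (lookup ms p) b y)
      ≡⟨ +-assoc (occursIf m b x) _ _ ⟨
    occursIf m b x + countOn ms b xs + occursIf (lookup ms p) b y   ∎
    where open ≡-Reasoning

  countOn-fill : ∀ (ms : Vec Bool m) b {ps : Vec (Fin m) k} → Unique ps → ∀ ys xs →
    countOn ms b (fill ps ys xs) + countOn (select ps ms) b (select ps xs) ≡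
    countOn ms b xs + countOn (select ps ms) b ys
  countOn-fill ms b []                          []       xs = refl
  countOn-fill ms b {p ∷ ps} (p∉ps ∷ unique) (y ∷ ys) xs = begin
    countOn ms b (fill ps ys xs′) + (occursIf mₚ b (lookup xs p) + countOn (select ps ms) b (select ps xs))
      ≡⟨ x∙yz≈xz∙y (countOn ms b (fill ps ys xs′)) _ (countOn (select ps ms) b (select ps xs)) ⟩
    countOn ms b (fill ps ys xs′) + countOn (select ps ms) b (select ps xs) + occursIf mₚ b (lookup xs p)
      ≡⟨ cong (λ zs → countOn ms b (fill ps ys xs′) + countOn (select ps ms) b zs + occursIf mₚ b (lookup xs p))
              (select-[]≔ p∉ps xs y) ⟨
    countOn ms b (fill ps ys xs′) + countOn (select ps ms) b (select ps xs′) + occursIf mₚ b (lookup xs p)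
      ≡⟨ cong (_+ occursIf mₚ b (lookup xs p)) (countOn-fill ms b unique ys xs′) ⟩
    countOn ms b xs′ + countOn (select ps ms) b ys + occursIf mₚ b (lookup xs p)
      ≡⟨ xy∙z≈xz∙y (countOn ms b xs′) (countOn (select ps ms) b ys) _ ⟩
    countOn ms b xs′ + occursIf mₚ b (lookup xs p) + countOn (select ps ms) b ys
      ≡⟨ cong (_+ countOn (select ps ms) b ys) (countOn-[]≔ ms b xs p y) ⟩
    countOn ms b xs + occursIf mₚ b y + countOn (select ps ms) b ys
      ≡⟨ +-assoc (countOn ms b xs) _ _ ⟩
    countOn ms b xs + (occursIf mₚ b y + countOn (select ps ms) b ys)   ∎
    where
    open ≡-Reasoning
    xs′ = xs [ p ]≔ y
    mₚ = lookup ms p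

  oneHot : Fin k → Vec Bool k
  oneHot j = replicate _ false [ j ]≔ true

  countOn-false : ∀ b (xs : Vec (Fin 2) k) → countOn (replicate k false) b xs ≡ 0
  countOn-false b []       = refl
  countOn-false b (x ∷ xs) = countOn-false b xs

  countOn-oneHot : ∀ (j : Fin k) b xs → countOn (oneHot j) b xs ≡ occurs b (lookup xs j)
  countOn-oneHot zero    b (x ∷ xs) = trans (cong (occurs b x +_) (countOn-false b xs)) (+-identityʳ _)
  countOn-oneHot (suc j) b (x ∷ xs) = countOn-oneHot j b xs

  weight : Vec (Fin 2) k → ℕ
  weight = count 0F

  ofWeight : ∀ k → ℕ → List (Vec (Fin 2) k)
  ofWeight zero    zero    = [] ∷ []
  ofWeight zero    (suc w) = []
  ofWeight (suc k) zero    = List.map (1F ∷_) (ofWeight k zero)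
  ofWeight (suc k) (suc w) = List.map (0F ∷_) (ofWeight k w) ++ List.map (1F ∷_) (ofWeight k (suc w))

  variantsOf : Vec (Fin 2) k → List (Vec (Fin 2) k)
  variantsOf π = filterᵇ (λ ρ → not (does (≡-dec _≟ᶠ_ ρ π))) (ofWeight _ (weight π))

  Gains : Vec (Fin 2) 4 → Fin 2 → Vec (Fin 2) 4 → Set
  Gains π b ρ = ∃ λ j → lookup π j ≢ b × lookup ρ j ≡ b

  variantsOf-gain : ∀ π b → ListAll.All (Gains π b) (variantsOf π)
  variantsOf-gain π = ListAll.lookup table (∈-allWords π)
    where
    table : ListAll.All (λ π → ∀ b → ListAll.All (Gains π b) (variantsOf π)) (allWords 4)
    table = from-yes (ListAll.all? (λ π → all? λ b → ListAll.all? (λ ρ →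
      any? λ j → ¬? (lookup π j ≟ᶠ b) ×-dec (lookup ρ j ≟ᶠ b)) (variantsOf π)) (allWords 4))

  monomial : Vec (Fin 2 → ℕ) k → Vec (Fin 2) k → ℕ
  monomial []       []       = 1
  monomial (ν ∷ νs) (y ∷ ys) = ν y * monomial νs ys

  δ : Vec (Fin 2) k → Vec (Fin 2) k → ℕ
  δ π = monomial (map occurs π)

  vec₂ : ℕ → ℕ → Fin 2 → ℕ
  vec₂ a b 0F = a
  vec₂ a b 1F = b

  -- A list of (c , a , b) stands for Σ c · (a e₁ + b e₂)^{⊗4}, read off at the letters y.
  Combination : Set
  Combination = List (ℕ × ℕ × ℕ)

  evaluate : Combination → Vec (Fin 2) k → ℕ
  evaluate []                  y = 0
  evaluate ((c , a , b) ∷ cs) y = c * monomial (replicate _ (vec₂ a b)) y + evaluate cs y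

  -- For weight w, (subtracted , total) satisfy total = 6 · [weight y ≡ w] + subtracted, i.e. they
  -- solve the Vandermonde system of the five generators (1,0), (0,1), (1,1), (2,1), (1,2).
  certificate : ℕ → Combination × Combination
  certificate 0 = [] , (6 , 0 , 1) ∷ []
  certificate 1 = (12 , 1 , 1) ∷ (21 , 0 , 1) ∷ (6 , 1 , 0) ∷ [] , (1 , 2 , 1) ∷ (2 , 1 , 2) ∷ []
  certificate 2 = (3 , 2 , 1) ∷ (3 , 1 , 2) ∷ [] , (30 , 1 , 1) ∷ (21 , 0 , 1) ∷ (21 , 1 , 0) ∷ []
  certificate 3 = (12 , 1 , 1) ∷ (6 , 0 , 1) ∷ (21 , 1 , 0) ∷ [] , (2 , 2 , 1) ∷ (1 , 1 , 2) ∷ []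
  certificate _ = [] , (6 , 1 , 0) ∷ []

  isolated interpolated : Vec (Fin 2) 4 → Vec (Fin 2) 4 → ℕ
  isolated π y = 6 * δ π y + (6 * sum (List.map (λ ρ → δ ρ y) (variantsOf π)) + evaluate (proj₁ (certificate (weight π))) y)
  interpolated π y = evaluate (proj₂ (certificate (weight π))) y

  isolated≡interpolated : ∀ π y → isolated π y ≡ interpolated π y
  isolated≡interpolated π y = ListAll.lookup (ListAll.lookup table (∈-allWords π)) (∈-allWords y)
    where
    table : ListAll.All (λ π → ListAll.All (λ y → isolated π y ≡ interpolated π y) (allWords 4)) (allWords 4)
    table = from-yes (ListAll.all? (λ π → ListAll.all? (λ y → isolated π y ≟ interpolated π y) (allWords 4)) (allWords 4))

open Words

module Tensors {c ℓ : Level} (R : CommutativeRing c ℓ) where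

  open import Data.Fin using (zero; suc)
  open import Data.Fin.Patterns using (0F; 1F)
  open import Data.List using (List; []; _∷_)
  import Data.List as List
  open import Data.List.Relation.Unary.All as ListAll using ()
  open import Data.Nat as ℕ using (ℕ)
  open import Data.Nat.ListAction using (sum)
  open import Data.Product using (_,_; proj₁; proj₂)
  open import Data.Vec using (Vec; []; _∷_; lookup; map; replicate; _[_]≔_; fromList)
  open import Data.Vec.Properties using (map-replicate)
  open import Data.Vec.Relation.Unary.AllPairs using ([]; _∷_)
  open import Data.Vec.Relation.Unary.Unique.Propositional using (Unique)
  open import Relation.Binary.PropositionalEquality as ≡ using (_≡_)

  open CommutativeRing R
  open import Algebra.Properties.Ring ring using (-1*x≈-x)
  open import Algebra.Properties.Semiring.Mult semiring using (×-homo-+; ×1-homo-*; ×-assoc-*; ×-assocˡ; ×-congʳ) renaming (_×_ to _·_)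
  open import Algebra.Properties.CommutativeSemigroup *-commutativeSemigroup using (x∙yz≈y∙xz)
  open import Relation.Binary.Reasoning.Setoid setoid

  private
    variable
      k m : ℕ

  module _ {n : ℕ} where

    private
      variable
        A B : Tensor R n

    vanishes-resp : (∀ w → A w ≈ B w) → VanishesInΛ R n A → VanishesInΛ R n B
    vanishes-resp A≈B (gs , A≈gs) = gs , λ w → trans (sym (A≈B w)) (A≈gs w)

    vanishes-0 : VanishesInΛ R n (λ _ → 0#)
    vanishes-0 = [] , λ _ → refl

    vanishes-simple : (v : Family R n) → Degenerate R v → VanishesInΛ R n (simple R v)
    vanishes-simple v degenerate = (1# , v , degenerate) ∷ [] , λ w → sym (trans (+-identityʳ _) (*-identityˡ _))

    vanishes-+ : VanishesInΛ R n A → VanishesInΛ R n B → VanishesInΛ R n (λ w → A w + B w)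
    vanishes-+ (gs , A≈gs) (hs , B≈hs) = gs List.++ hs , λ w → trans (+-cong (A≈gs w) (B≈hs w)) (sym (combo-++ gs w))
      where
      combo-++ : ∀ gs w → combo R (gs List.++ hs) w ≈ combo R gs w + combo R hs w
      combo-++ []                 w = sym (+-identityˡ _)
      combo-++ ((a , v , _) ∷ gs) w = trans (+-congˡ (combo-++ gs w)) (sym (+-assoc _ _ _))

    vanishes-* : ∀ x → VanishesInΛ R n A → VanishesInΛ R n (λ w → x * A w)
    vanishes-* x (gs , A≈gs) = List.map scale gs , λ w → trans (*-congˡ (A≈gs w)) (sym (combo-map w gs))
      where
      scale : Generator R n → Generator R n
      scale (a , rest) = x * a , rest
      combo-map : ∀ w gs → combo R (List.map scale gs) w ≈ x * combo R gs w
      combo-map w []                 = sym (zeroʳ x)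
      combo-map w ((a , v , _) ∷ gs) = begin
        x * a * simple R v w + combo R (List.map scale gs) w  ≈⟨ +-cong (*-assoc x a _) (combo-map w gs) ⟩
        x * (a * simple R v w) + x * combo R gs w            ≈⟨ distribˡ x _ _ ⟨
        x * (a * simple R v w + combo R gs w)                ∎

    vanishes-· : ∀ k → VanishesInΛ R n A → VanishesInΛ R n (λ w → k · A w)
    vanishes-· ℕ.zero    _     = vanishes-0
    vanishes-· (ℕ.suc k) A-van = vanishes-+ A-van (vanishes-· k A-van)

    vanishes-cancel : VanishesInΛ R n B → VanishesInΛ R n (λ w → A w + B w) → VanishesInΛ R n A
    vanishes-cancel {B = B} {A = A} B-van A+B-van =
      vanishes-resp A+B-B≈A (vanishes-+ A+B-van (vanishes-* (- 1#) B-van))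
      where
      A+B-B≈A : ∀ w → A w + B w + - 1# * B w ≈ A w
      A+B-B≈A w = begin
        A w + B w + - 1# * B w  ≈⟨ +-congˡ (-1*x≈-x (B w)) ⟩
        A w + B w + - B w       ≈⟨ +-assoc _ _ _ ⟩
        A w + (B w + - B w)     ≈⟨ +-congˡ (-‿inverseʳ (B w)) ⟩
        A w + 0#                ≈⟨ +-identityʳ (A w) ⟩
        A w                     ∎

    vanishes-*-unit : ∀ {x y} → x * y ≈ 1# → VanishesInΛ R n (λ w → y * A w) → VanishesInΛ R n A
    vanishes-*-unit {A = A} {x} {y} x*y≈1 yA-van = vanishes-resp x*yA≈A (vanishes-* x yA-van)
      where
      x*yA≈A : ∀ w → x * (y * A w) ≈ A w
      x*yA≈A w = trans (sym (*-assoc x y (A w))) (trans (*-congʳ x*y≈1) (*-identityˡ (A w)))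

  ∏ : Vec (V₂ R) m → Vec (Fin 2) m → Carrier
  ∏ []       []       = 1#
  ∏ (f ∷ fs) (x ∷ xs) = f x * ∏ fs xs

  basis : Vec (Fin 2) m → Vec (Fin 2) m → Carrier
  basis β = ∏ (map (e R) β)

  prodOver≡∏ : ∀ {n} (v : Family R n) ts w → prodOver R v ts w ≡ ∏ (map (λ (i , j , k) → v i j k) (fromList ts)) w
  prodOver≡∏ v []              []      = ≡.refl
  prodOver≡∏ v ((i , j , k) ∷ ts) (b ∷ bs) = ≡.cong (v i j k b *_) (prodOver≡∏ v ts bs)

  one : V₂ R
  one _ = 1#

  blank : Vec (Fin m) k → Vec (V₂ R) m → Vec (V₂ R) m
  blank ps = fill ps (replicate _ one)

  ∏-[]≔ : ∀ (fs : Vec (V₂ R) m) w p → ∏ fs w ≈ lookup fs p (lookup w p) * ∏ (fs [ p ]≔ one) w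
  ∏-[]≔ (f ∷ fs) (x ∷ w) zero    = *-congˡ (sym (*-identityˡ _))
  ∏-[]≔ (f ∷ fs) (x ∷ w) (suc p) = begin
    f x * ∏ fs w                                            ≈⟨ *-congˡ (∏-[]≔ fs w p) ⟩
    f x * (lookup fs p (lookup w p) * ∏ (fs [ p ]≔ one) w)   ≈⟨ x∙yz≈y∙xz _ _ _ ⟩
    lookup fs p (lookup w p) * (f x * ∏ (fs [ p ]≔ one) w)   ∎

  ∏-split : ∀ {ps : Vec (Fin m) k} → Unique ps → ∀ fs w →
    ∏ fs w ≈ ∏ (select ps fs) (select ps w) * ∏ (blank ps fs) w
  ∏-split []                        fs w = sym (*-identityˡ _)
  ∏-split {ps = p ∷ ps} (p∉ps ∷ unique) fs w = begin
    ∏ fs w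
      ≈⟨ ∏-[]≔ fs w p ⟩
    lookup fs p (lookup w p) * ∏ (fs [ p ]≔ one) w
      ≈⟨ *-congˡ (∏-split unique (fs [ p ]≔ one) w) ⟩
    lookup fs p (lookup w p) * (∏ (select ps (fs [ p ]≔ one)) (select ps w) * ∏ (blank ps (fs [ p ]≔ one)) w)
      ≡⟨ ≡.cong (λ gs → lookup fs p (lookup w p) * (∏ gs (select ps w) * ∏ (blank ps (fs [ p ]≔ one)) w))
                (select-[]≔ p∉ps fs one) ⟩
    lookup fs p (lookup w p) * (∏ (select ps fs) (select ps w) * ∏ (blank ps (fs [ p ]≔ one)) w)
      ≈⟨ *-assoc _ _ _ ⟨
    ∏ (select (p ∷ ps) fs) (select (p ∷ ps) w) * ∏ (blank (p ∷ ps) fs) w   ∎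

  ∏-fill : ∀ {ps : Vec (Fin m) k} → Unique ps → ∀ gs fs w →
    ∏ (fill ps gs fs) w ≈ ∏ gs (select ps w) * ∏ (blank ps fs) w
  ∏-fill {ps = ps} unique gs fs w = trans (∏-split unique _ w)
    (reflexive (≡.cong₂ (λ hs fs′ → ∏ hs (select ps w) * ∏ fs′ w) (select-fill unique gs fs) (fill-fill unique _ gs fs)))

  lift : (Fin 2 → ℕ) → V₂ R
  lift ν d = ν d · 1#

  ∏-lift : ∀ (νs : Vec (Fin 2 → ℕ) k) y → ∏ (map lift νs) y ≈ monomial νs y · 1#
  ∏-lift []       []       = sym (+-identityʳ 1#)
  ∏-lift (ν ∷ νs) (y ∷ ys) = trans (*-congˡ (∏-lift νs ys)) (sym (×1-homo-* (ν y) (monomial νs ys)))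

  e≈lift-occurs : ∀ b d → e R b d ≈ lift (occurs b) d
  e≈lift-occurs 0F 0F = sym (+-identityʳ 1#)
  e≈lift-occurs 0F 1F = refl
  e≈lift-occurs 1F 0F = refl
  e≈lift-occurs 1F 1F = sym (+-identityʳ 1#)

  basis-δ : ∀ (π y : Vec (Fin 2) k) → basis π y ≈ δ π y · 1#
  basis-δ []       []       = sym (+-identityʳ 1#)
  basis-δ (b ∷ π) (d ∷ y) =
    trans (*-cong (e≈lift-occurs b d) (basis-δ π y)) (sym (×1-homo-* (occurs b d) (δ π y)))

  module Symmetrisation {n : ℕ} {six⁻¹ : Carrier} (six⁻¹-inverse : six⁻¹ * (6 · 1#) ≈ 1#)
    {ps : Vec (Fin (N n)) 4} (unique : Unique ps) (β : Word n)
    (generator : ∀ u → VanishesInΛ R n (∏ (fill ps (replicate 4 u) (map (e R) β)))) where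

    private
      ρ : Tensor R n
      ρ = ∏ (blank ps (map (e R) β))

    Φ : (Vec (Fin 2) 4 → ℕ) → Tensor R n
    Φ f w = f (select ps w) · ρ w

    private
      ×1* : ∀ k x → (k · 1#) * x ≈ k · x
      ×1* k x = trans (×-assoc-* k 1# x) (×-congʳ k (*-identityˡ x))

    Φ-+ : ∀ f g w → Φ (λ y → f y ℕ.+ g y) w ≈ Φ f w + Φ g w
    Φ-+ f g w = ×-homo-+ (ρ w) (f (select ps w)) (g (select ps w))

    vanishes-Φ-+ : ∀ f g → VanishesInΛ R n (Φ f) → VanishesInΛ R n (Φ g) → VanishesInΛ R n (Φ (λ y → f y ℕ.+ g y))
    vanishes-Φ-+ f g f-van g-van = vanishes-resp (λ w → sym (Φ-+ f g w)) (vanishes-+ f-van g-van)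

    vanishes-Φ-* : ∀ k f → VanishesInΛ R n (Φ f) → VanishesInΛ R n (Φ (λ y → k ℕ.* f y))
    vanishes-Φ-* k f f-van = vanishes-resp (λ w → ×-assocˡ (ρ w) k (f (select ps w))) (vanishes-· k f-van)

    vanishes-Φ-6* : ∀ f → VanishesInΛ R n (Φ (λ y → 6 ℕ.* f y)) → VanishesInΛ R n (Φ f)
    vanishes-Φ-6* f 6f-van = vanishes-*-unit six⁻¹-inverse (vanishes-resp 6f≈6*f 6f-van)
      where
      6f≈6*f : ∀ w → Φ (λ y → 6 ℕ.* f y) w ≈ (6 · 1#) * Φ f w
      6f≈6*f w = trans (sym (×-assocˡ (ρ w) 6 (f (select ps w)))) (sym (×1* 6 (Φ f w)))

    Φ-δ : ∀ π w → basis (fill ps π β) w ≈ Φ (δ π) w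
    Φ-δ π w = begin
      ∏ (map (e R) (fill ps π β)) w                  ≡⟨ ≡.cong (λ fs → ∏ fs w) (map-fill (e R) ps π β) ⟩
      ∏ (fill ps (map (e R) π) (map (e R) β)) w      ≈⟨ ∏-fill unique _ _ w ⟩
      basis π (select ps w) * ρ w                    ≈⟨ *-congʳ (basis-δ π (select ps w)) ⟩
      (δ π (select ps w) · 1#) * ρ w                 ≈⟨ ×1* (δ π (select ps w)) (ρ w) ⟩
      Φ (δ π) w                                      ∎

    Φ-generator : ∀ ν w → ∏ (fill ps (replicate 4 (lift ν)) (map (e R) β)) w ≈ Φ (monomial (replicate 4 ν)) w
    Φ-generator ν w = begin
      ∏ (fill ps (replicate 4 (lift ν)) (map (e R) β)) w  ≈⟨ ∏-fill unique _ _ w ⟩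
      ∏ (replicate 4 (lift ν)) (select ps w) * ρ w        ≡⟨ ≡.cong (λ fs → ∏ fs (select ps w) * ρ w) (map-replicate lift ν 4) ⟨
      ∏ (map lift (replicate 4 ν)) (select ps w) * ρ w    ≈⟨ *-congʳ (∏-lift (replicate 4 ν) (select ps w)) ⟩
      (monomial (replicate 4 ν) (select ps w) · 1#) * ρ w     ≈⟨ ×1* (monomial (replicate 4 ν) (select ps w)) (ρ w) ⟩
      Φ (monomial (replicate 4 ν)) w                          ∎

    vanishes-evaluate : ∀ L → VanishesInΛ R n (Φ (evaluate L))
    vanishes-evaluate []                  = vanishes-0
    vanishes-evaluate ((c , a , b) ∷ L) = vanishes-Φ-+ (λ y → c ℕ.* monomial (replicate 4 (vec₂ a b)) y) (evaluate L)
      (vanishes-Φ-* c (monomial (replicate 4 (vec₂ a b))) (vanishes-resp (Φ-generator (vec₂ a b)) (generator (lift (vec₂ a b)))))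
      (vanishes-evaluate L)

    vanishes-Φ-sum : ∀ (h : Vec (Fin 2) 4 → Vec (Fin 2) 4 → ℕ) L → ListAll.All (λ π → VanishesInΛ R n (Φ (h π))) L →
      VanishesInΛ R n (Φ (λ y → sum (List.map (λ π → h π y) L)))
    vanishes-Φ-sum h []      ListAll.[]             = vanishes-0
    vanishes-Φ-sum h (π ∷ L) (π-van ListAll.∷ L-van) =
      vanishes-Φ-+ (h π) (λ y → sum (List.map (λ π → h π y) L)) π-van (vanishes-Φ-sum h L L-van)

    vanishes-by-variants : ListAll.All (λ π → VanishesInΛ R n (basis (fill ps π β))) (variantsOf (select ps β)) →
      VanishesInΛ R n (basis β)
    vanishes-by-variants variants-van =
      ≡.subst (λ β′ → VanishesInΛ R n (basis β′)) (fill-select ps β)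
        (vanishes-resp (λ w → sym (Φ-δ π₀ w))
          (vanishes-Φ-6* (δ π₀) (vanishes-cancel rest-van (vanishes-resp (Φ-+ (λ y → 6 ℕ.* δ π₀ y) rest) total-van))))
      where
      π₀ = select ps β
      rest : Vec (Fin 2) 4 → ℕ
      rest y = 6 ℕ.* sum (List.map (λ π → δ π y) (variantsOf π₀)) ℕ.+ evaluate (proj₁ (certificate (weight π₀))) y
      rest-van : VanishesInΛ R n (Φ rest)
      rest-van = vanishes-Φ-+ (λ y → 6 ℕ.* sum (List.map (λ π → δ π y) (variantsOf π₀))) (evaluate (proj₁ (certificate (weight π₀))))
        (vanishes-Φ-* 6 (λ y → sum (List.map (λ π → δ π y) (variantsOf π₀))) (vanishes-Φ-sum δ _ (ListAll.map (vanishes-resp (Φ-δ _)) variants-van)))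
        (vanishes-evaluate (proj₁ (certificate (weight π₀))))
      total-van : VanishesInΛ R n (Φ (λ y → 6 ℕ.* δ π₀ y ℕ.+ rest y))
      total-van = vanishes-resp (λ w → reflexive (≡.cong (_· ρ w) (≡.sym (isolated≡interpolated π₀ (select ps w)))))
                                (vanishes-evaluate (proj₂ (certificate (weight π₀))))

open Tensors

module CompleteGraph where

  open import Data.Bool using (Bool; not; _∨_)
  open import Data.Bool.Properties using () renaming (_≟_ to _≟ᵇ_)
  open import Data.Fin using (#_; _<_)
  open import Data.Fin.Patterns using (0F; 1F; 2F; 3F; 4F; 5F)
  open import Data.Fin.Properties using (_≟_; _<?_; all?)
  open import Data.List using (List; []; _∷_)
  open import Data.Product using (_×_; _,_; proj₁; proj₂)
  open import Data.Vec using (Vec; []; _∷_; lookup; map)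
  open import Data.Vec.Properties using (≡-dec)
  open import Data.Vec.Relation.Unary.AllPairs using (allPairs?)
  open import Data.Vec.Relation.Unary.Unique.Propositional using (Unique)
  open import Relation.Nullary using (Dec; does; ¬?; _×-dec_)
  open import Relation.Nullary.Decidable using (True; toWitness; from-yes)
  open import Relation.Binary.PropositionalEquality using (_≡_; refl)

  Position : Set
  Position = Fin 20

  Word₆ : Set
  Word₆ = Vec (Fin 2) 20

  triangles : Vec (Triple 6) 20
  triangles =
    (0F , 1F , 2F) ∷ (0F , 1F , 3F) ∷ (0F , 1F , 4F) ∷ (0F , 1F , 5F) ∷
    (0F , 2F , 3F) ∷ (0F , 2F , 4F) ∷ (0F , 2F , 5F) ∷ (0F , 3F , 4F) ∷
    (0F , 3F , 5F) ∷ (0F , 4F , 5F) ∷ (1F , 2F , 3F) ∷ (1F , 2F , 4F) ∷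
    (1F , 2F , 5F) ∷ (1F , 3F , 4F) ∷ (1F , 3F , 5F) ∷ (1F , 4F , 5F) ∷
    (2F , 3F , 4F) ∷ (2F , 3F , 5F) ∷ (2F , 4F , 5F) ∷ (3F , 4F , 5F) ∷ []

  triangle : Position → Triple 6
  triangle = lookup triangles

  position : Triple 6 → Position
  position (0F , 1F , 2F) = # 0
  position (0F , 1F , 3F) = # 1
  position (0F , 1F , 4F) = # 2
  position (0F , 1F , 5F) = # 3
  position (0F , 2F , 3F) = # 4
  position (0F , 2F , 4F) = # 5
  position (0F , 2F , 5F) = # 6
  position (0F , 3F , 4F) = # 7
  position (0F , 3F , 5F) = # 8
  position (0F , 4F , 5F) = # 9
  position (1F , 2F , 3F) = # 10
  position (1F , 2F , 4F) = # 11
  position (1F , 2F , 5F) = # 12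
  position (1F , 3F , 4F) = # 13
  position (1F , 3F , 5F) = # 14
  position (1F , 4F , 5F) = # 15
  position (2F , 3F , 4F) = # 16
  position (2F , 3F , 5F) = # 17
  position (2F , 4F , 5F) = # 18
  position (3F , 4F , 5F) = # 19
  position _             = # 0   -- junk for triples that are not increasing

  wordOf : (Fin 6 → Fin 6 → Fin 6 → Fin 2) → Word₆
  wordOf b = map (λ (i , j , k) → b i j k) triangles

  countE₁≡count : ∀ b → countE₁ b ≡ count 0F (wordOf b)
  countE₁≡count b = count-filter (λ (i , j , k) → b i j k) (triples 6)

  position∘triangle : ∀ p → position (triangle p) ≡ p
  position∘triangle = from-yes (all? λ p → position (triangle p) ≟ p)

  avoids : Fin 6 → Triple 6 → Bool
  avoids v (i , j , k) = not (does (v ≟ i) ∨ does (v ≟ j) ∨ does (v ≟ k))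

  -- the triangles of the K₅ on the five vertices other than v
  mask : Fin 6 → Vec Bool 20
  mask v = map (avoids v) triangles

  facesOf : (x y z t : Fin 6) → Vec Position 4
  facesOf x y z t = position (x , y , z) ∷ position (x , y , t) ∷ position (x , z , t) ∷ position (y , z , t) ∷ []

  -- the vertex of the quadruple missing from the corresponding face
  apexesOf : (x y z t : Fin 6) → Vec (Fin 6) 4
  apexesOf x y z t = t ∷ z ∷ y ∷ x ∷ []

  record Quad : Set where
    constructor mkQuad
    field
      x y z t       : Fin 6
      faces         : Vec Position 4
      apexes        : Vec (Fin 6) 4
      increasing    : x < y × y < z × z < t
      faces≡facesOf : faces ≡ facesOf x y z t
      faces-unique  : Unique faces
      avoiding-apex : ∀ j → select faces (mask (lookup apexes j)) ≡ oneHot j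

  wellFormed? : ∀ x y z t → Dec ((x < y × y < z × z < t) × Unique (facesOf x y z t) ×
    (∀ j → select (facesOf x y z t) (mask (lookup (apexesOf x y z t) j)) ≡ oneHot j))
  wellFormed? x y z t = (x <? y ×-dec y <? z ×-dec z <? t) ×-dec allPairs? (λ p q → ¬? (p ≟ q)) _ ×-dec
    all? (λ j → ≡-dec _≟ᵇ_ (select (facesOf x y z t) (mask (lookup (apexesOf x y z t) j))) (oneHot j))

  quad : ∀ x y z t → {True (wellFormed? x y z t)} → Quad
  quad x y z t {w} = mkQuad x y z t (facesOf x y z t) (apexesOf x y z t)
    (proj₁ (toWitness w)) refl (proj₁ (proj₂ (toWitness w))) (proj₂ (proj₂ (toWitness w)))

  quads : List Quad
  quads =
    quad 0F 1F 2F 3F ∷ quad 0F 1F 2F 4F ∷ quad 0F 1F 2F 5F ∷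
    quad 0F 1F 3F 4F ∷ quad 0F 1F 3F 5F ∷ quad 0F 1F 4F 5F ∷
    quad 0F 2F 3F 4F ∷ quad 0F 2F 3F 5F ∷ quad 0F 2F 4F 5F ∷
    quad 0F 3F 4F 5F ∷ quad 1F 2F 3F 4F ∷ quad 1F 2F 3F 5F ∷
    quad 1F 2F 4F 5F ∷ quad 1F 3F 4F 5F ∷ quad 2F 3F 4F 5F ∷ []

open CompleteGraph

module Certificates where

  open import Data.Bool using (Bool; true; false; T; not; _∧_; _∨_)
  open import Data.Bool.ListAction using (any; all)
  open import Data.Empty using (⊥-elim)
  open import Data.Fin as Fin using (zero; suc)
  open import Data.Fin.Patterns using (0F; 1F; 2F; 3F; 4F; 5F)
  open import Data.List using (List; []; _∷_; null; filterᵇ)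
  open import Data.Nat as ℕ using (ℕ; _+_; _<_; _<ᵇ_; _≤ᵇ_; s≤s)
  open import Data.Nat.Properties
    using (<ᵇ⇒<; ≤ᵇ⇒≤; ≤-trans; m≤m+n; ≤⇒≯; <-irrefl; +-mono-≤; +-identityʳ; +-comm; +-commutativeSemigroup)
  open import Algebra.Properties.CommutativeSemigroup +-commutativeSemigroup using (xy∙z≈y∙xz)
  open import Data.Product using (∃; _×_; _,_; proj₁; proj₂)
  open import Data.Sum using (_⊎_; [_,_]; inj₁; inj₂)
  open import Data.Unit using (tt)
  open import Data.Vec using (Vec; []; _∷_; lookup; map; replicate; tabulate; toList)
  open import Data.Vec.Properties using (lookup∘tabulate; lookup-replicate; lookup-map; map-∘; map-cong; tabulate∘lookup)
  open import Data.Bool.Properties using (T-≡)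
  open import Data.List.Relation.Unary.All as ListAll using ()
  open import Data.List.Relation.Unary.All.Properties using (all⁺)
  open import Data.List.Relation.Unary.Any using (satisfied)
  open import Data.List.Relation.Unary.Any.Properties using (any⁻)
  open import Function using (_∘_; id; Equivalence)
  open import Relation.Nullary using (does)
  open import Relation.Nullary.Decidable using (isYes; toWitness)
  open import Relation.Binary.PropositionalEquality as ≡ using (_≡_; _≢_; refl)

  ∨-split : ∀ x {y} → T (x ∨ y) → T x ⊎ T y
  ∨-split true  _ = inj₁ tt
  ∨-split false h = inj₂ h

  ∧-fst : ∀ x {y} → T (x ∧ y) → T x
  ∧-fst true _ = tt

  ∧-snd : ∀ x {y} → T (x ∧ y) → T y
  ∧-snd true h = h

  lettersOn : Quad → Word₆ → Vec (Fin 2) 4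
  lettersOn q = select (Quad.faces q)

  variant : Quad → Word₆ → Vec (Fin 2) 4 → Word₆
  variant q β π = fill (Quad.faces q) π β

  variants : Quad → Word₆ → List (Vec (Fin 2) 4)
  variants q β = variantsOf (lettersOn q β)

  countAvoiding : Fin 6 → Fin 2 → Word₆ → ℕ
  countAvoiding v = countOn (mask v)

  quadsAvoiding : Fin 6 → List Quad
  quadsAvoiding v = filterᵇ (λ q → not (any (λ u → does (u Fin.≟ v)) (toList (Quad.apexes q)))) quads

  balancedOn : Vec Bool 20 → Word₆ → Bool
  balancedOn m β = (countOn m 0F β ≤ᵇ 6) ∧ (countOn m 1F β ≤ᵇ 6)

  someMonochromatic : List Quad → Word₆ → Bool
  someMonochromatic qs β = any (λ q → null (variants q β)) qs

  reducibleWithin : List Quad → Word₆ → Bool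
  reducibleWithin qs β = any (λ q → all (someMonochromatic qs ∘ variant q β) (variants q β)) qs

  k₅Certificate : Vec Bool 20 → List Quad → Word₆ → Bool
  k₅Certificate m qs β = balancedOn m β ∨ someMonochromatic qs β ∨ reducibleWithin qs β

  balancedOn-≤ : ∀ m β → T (balancedOn m β) → ∀ b → countOn m b β ℕ.≤ 6
  balancedOn-≤ m β h 0F = ≤ᵇ⇒≤ _ 6 (∧-fst (countOn m 0F β ≤ᵇ 6) h)
  balancedOn-≤ m β h 1F = ≤ᵇ⇒≤ _ 6 (∧-snd (countOn m 0F β ≤ᵇ 6) h)

  Counts : Set
  Counts = Vec (ℕ × ℕ) 6

  letter : Fin 2 → ℕ × ℕ → ℕ
  letter 0F = proj₁
  letter 1F = proj₂

  bump : Fin 2 → ℕ × ℕ → ℕ × ℕ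
  bump 0F (a , b) = 1 + a , b
  bump 1F (a , b) = a , 1 + b

  bumpWhere : ∀ {k} → Vec Bool k → Fin 2 → Vec (ℕ × ℕ) k → Vec (ℕ × ℕ) k
  bumpWhere []            x []       = []
  bumpWhere (true  ∷ col) x (c ∷ cs) = bump x c ∷ bumpWhere col x cs
  bumpWhere (false ∷ col) x (c ∷ cs) = c ∷ bumpWhere col x cs

  letter-bumpWhere : ∀ {k} (col : Vec Bool k) x cs v b →
    letter b (lookup (bumpWhere col x cs) v) ≡ occursIf (lookup col v) b x + letter b (lookup cs v)
  letter-bumpWhere (true  ∷ col) 0F (c ∷ cs) zero    0F = refl
  letter-bumpWhere (true  ∷ col) 0F (c ∷ cs) zero    1F = refl
  letter-bumpWhere (true  ∷ col) 1F (c ∷ cs) zero    0F = refl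
  letter-bumpWhere (true  ∷ col) 1F (c ∷ cs) zero    1F = refl
  letter-bumpWhere (false ∷ col) x  (c ∷ cs) zero    b  = refl
  letter-bumpWhere (true  ∷ col) x  (c ∷ cs) (suc v) b  = letter-bumpWhere col x cs v b
  letter-bumpWhere (false ∷ col) x  (c ∷ cs) (suc v) b  = letter-bumpWhere col x cs v b

  saturated : ∀ {k} → Vec (ℕ × ℕ) k → Bool
  saturated []             = false
  saturated ((a , b) ∷ cs) = (6 <ᵇ a) ∨ (6 <ᵇ b) ∨ saturated cs

  saturated-sound : ∀ {k} (cs : Vec (ℕ × ℕ) k) → T (saturated cs) → ∃ λ v → ∃ λ b → 6 < letter b (lookup cs v)
  saturated-sound ((a , a′) ∷ cs) h with ∨-split (6 <ᵇ a) h
  ... | inj₁ 6<a = zero , 0F , <ᵇ⇒< 6 a 6<a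
  ... | inj₂ h′ with ∨-split (6 <ᵇ a′) h′
  ...   | inj₁ 6<a′ = zero , 1F , <ᵇ⇒< 6 a′ 6<a′
  ...   | inj₂ h″   = let v , b , 6<c = saturated-sound cs h″ in suc v , b , 6<c

  hopeless : Counts → ℕ → Bool
  hopeless cs e₂s = (9 <ᵇ e₂s) ∨ saturated cs

  saturatedOn : ∀ {k} → Vec Position k → Vec (Fin 6) k → Word₆ → Counts → Fin 2 → Bool
  saturatedOn []       []       β cs b = true
  saturatedOn (p ∷ ps) (a ∷ as) β cs b =
    ((6 ≤ᵇ letter b (lookup cs a)) ∨ isYes (lookup β p Fin.≟ b)) ∧ saturatedOn ps as β cs b

  saturatedOn-sound : ∀ {k} (ps : Vec Position k) as β cs b → T (saturatedOn ps as β cs b) →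
    ∀ j → 6 ℕ.≤ letter b (lookup cs (lookup as j)) ⊎ lookup β (lookup ps j) ≡ b
  saturatedOn-sound (p ∷ ps) (a ∷ as) β cs b h zero
    with ∨-split (6 ≤ᵇ letter b (lookup cs a)) (∧-fst ((6 ≤ᵇ letter b (lookup cs a)) ∨ isYes (lookup β p Fin.≟ b)) h)
  ... | inj₁ saturated-a = inj₁ (≤ᵇ⇒≤ 6 _ saturated-a)
  ... | inj₂ p-carries-b = inj₂ (toWitness p-carries-b)
  saturatedOn-sound (p ∷ ps) (a ∷ as) β cs b h (suc j) =
    saturatedOn-sound ps as β cs b (∧-snd ((6 ≤ᵇ letter b (lookup cs a)) ∨ isYes (lookup β p Fin.≟ b)) h) j

  quadReducible : List Quad → Word₆ → Counts → Bool
  quadReducible qs β cs = any (λ q → side q 0F ∨ side q 1F) qs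
    where
    side : Quad → Fin 2 → Bool
    side q = saturatedOn (Quad.faces q) (Quad.apexes q) β cs

  search : ∀ {n} → Vec (Vec Bool 6) n → List Quad → (Vec (Fin 2) n → Word₆) → Counts → ℕ → Bool
  search []            qs complete cs e₂s = hopeless cs e₂s ∨ quadReducible qs (complete []) cs
  search (col ∷ cols) qs complete cs e₂s = hopeless cs e₂s ∨
    (search cols qs (complete ∘ (0F ∷_)) (bumpWhere col 0F cs) e₂s ∧
     search cols qs (complete ∘ (1F ∷_)) (bumpWhere col 1F cs) (1 + e₂s))

  columns : Vec (Vec Bool 6) 20
  columns = map (λ t → tabulate (λ v → avoids v t)) triangles

  start : Counts
  start = replicate 6 (0 , 0)

  Consistent : ∀ {n} → Vec (Vec Bool 6) n → (Vec (Fin 2) n → Word₆) → Counts → ℕ → Set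
  Consistent cols complete cs e₂s = ∀ xs →
    (∀ v b → letter b (lookup cs v) + countOn (map (λ col → lookup col v) cols) b xs ≡ countAvoiding v b (complete xs)) ×
    (e₂s + count 1F xs ≡ count 1F (complete xs))

  consistent-bump : ∀ {n} col (cols : Vec (Vec Bool 6) n) complete cs e₂s → Consistent (col ∷ cols) complete cs e₂s →
    ∀ x → Consistent cols (complete ∘ (x ∷_)) (bumpWhere col x cs) (occurs 1F x + e₂s)
  consistent-bump col cols complete cs e₂s consistent x xs =
    (λ v b → ≡.trans (≡.cong (_+ countOn (map (λ col → lookup col v) cols) b xs) (letter-bumpWhere col x cs v b))
                     (≡.trans (xy∙z≈y∙xz (occursIf (lookup col v) b x) _ _) (proj₁ (consistent (x ∷ xs)) v b))) ,
    ≡.trans (xy∙z≈y∙xz (occurs 1F x) e₂s _) (proj₂ (consistent (x ∷ xs)))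

  consistent-start : Consistent columns id start 0
  consistent-start β = (λ v b → ≡.cong₂ _+_ (empty v b) (≡.cong (λ m → countOn m b β) (columns-mask v))) , refl
    where
    empty : ∀ v b → letter b (lookup start v) ≡ 0
    empty v 0F = ≡.cong proj₁ (lookup-replicate v (0 , 0))
    empty v 1F = ≡.cong proj₂ (lookup-replicate v (0 , 0))

    columns-mask : ∀ v → map (λ col → lookup col v) columns ≡ mask v
    columns-mask v = ≡.trans (≡.sym (map-∘ (λ col → lookup col v) (λ t → tabulate (λ u → avoids u t)) triangles))
                             (map-cong (λ t → lookup∘tabulate (λ u → avoids u t) v) triangles)

  data Reducible : Word₆ → Set where
    via : ∀ q {β} → ListAll.All (Reducible ∘ variant q β) (variants q β) → Reducible β

  private
    null-All : ∀ {a p} {A : Set a} {P : A → Set p} (xs : List A) → T (null xs) → ListAll.All P xs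
    null-All [] _ = ListAll.[]

  reducible-someMonochromatic : ∀ qs β → T (someMonochromatic qs β) → Reducible β
  reducible-someMonochromatic qs β h =
    let q , no-variants = satisfied (any⁻ _ qs h) in via q (null-All (variants q β) no-variants)

  reducible-reducibleWithin : ∀ qs β → T (reducibleWithin qs β) → Reducible β
  reducible-reducibleWithin qs β h =
    let q , monochromatic = satisfied (any⁻ _ qs h)
    in via q (ListAll.map (reducible-someMonochromatic qs (variant q β _)) (all⁺ _ (variants q β) monochromatic))

  -- β is only used through tabulate (lookup β): its letters off the K₅ stay symbolic, and the
  -- certificate never inspects them.
  k₅Certified : ∀ v β → all (k₅Certificate (mask v) (quadsAvoiding v)) (enumerateOn (mask v) (tabulate (lookup β))) ≡ true
  k₅Certified 0F β = refl
  k₅Certified 1F β = refl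
  k₅Certified 2F β = refl
  k₅Certified 3F β = refl
  k₅Certified 4F β = refl
  k₅Certified 5F β = refl

  k₅Certificate-holds : ∀ v β → T (k₅Certificate (mask v) (quadsAvoiding v) β)
  k₅Certificate-holds v β = ≡.subst (T ∘ k₅Certificate (mask v) (quadsAvoiding v)) (tabulate∘lookup β)
    (ListAll.lookup (all⁺ (k₅Certificate (mask v) (quadsAvoiding v)) (enumerateOn (mask v) (tabulate (lookup β)))
                          (Equivalence.from T-≡ (k₅Certified v β)))
                    (∈-enumerateOn (mask v) (tabulate (lookup β))))

  reducible-unbalanced : ∀ v b β → 7 ℕ.≤ countAvoiding v b β → Reducible β
  reducible-unbalanced v b β seven =
    [ (λ balanced → ⊥-elim (≤⇒≯ (balancedOn-≤ (mask v) β balanced b) seven))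
    , [ reducible-someMonochromatic (quadsAvoiding v) β , reducible-reducibleWithin (quadsAvoiding v) β ]
      ∘ ∨-split (someMonochromatic (quadsAvoiding v) β) ]
    (∨-split (balancedOn (mask v) β) (k₅Certificate-holds v β))

  variant-gains-letter : ∀ q β ρ j b → lookup ρ j ≡ b → lookup (lettersOn q β) j ≢ b →
    countAvoiding (lookup (Quad.apexes q) j) b (variant q β ρ) ≡ ℕ.suc (countAvoiding (lookup (Quad.apexes q) j) b β)
  variant-gains-letter q β ρ j b ρⱼ≡b πⱼ≢b = begin
    countOn (mask a) b (fill faces ρ β)                                   ≡⟨ +-identityʳ _ ⟨
    countOn (mask a) b (fill faces ρ β) + 0                               ≡⟨ ≡.cong (countOn (mask a) b (fill faces ρ β) +_) lost ⟨
    countOn (mask a) b (fill faces ρ β) + countOn face b (select faces β) ≡⟨ countOn-fill (mask a) b faces-unique ρ β ⟩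
    countOn (mask a) b β + countOn face b ρ                               ≡⟨ ≡.cong (countOn (mask a) b β +_) gained ⟩
    countOn (mask a) b β + 1                                              ≡⟨ +-comm _ 1 ⟩
    ℕ.suc (countOn (mask a) b β)                                          ∎
    where
    open Quad q
    open ≡.≡-Reasoning
    a = lookup apexes j
    face = select faces (mask a)
    face-oneHot : ∀ xs → countOn face b xs ≡ occurs b (lookup xs j)
    face-oneHot xs = ≡.trans (≡.cong (λ m → countOn m b xs) (avoiding-apex j)) (countOn-oneHot j b xs)
    gained : countOn face b ρ ≡ 1
    gained = ≡.trans (face-oneHot ρ) (≡.trans (≡.cong (occurs b) ρⱼ≡b) (occurs-refl b))
    lost : countOn face b (select faces β) ≡ 0
    lost = ≡.trans (face-oneHot (select faces β)) (occurs-≢ (λ b≡πⱼ → πⱼ≢b (≡.sym b≡πⱼ)))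

  reducible-quadReducible : ∀ qs β cs → (∀ v b → letter b (lookup cs v) ≡ countAvoiding v b β) →
    T (quadReducible qs β cs) → Reducible β
  reducible-quadReducible qs β cs exact h =
    let q , sides = satisfied (any⁻ _ qs h) in
    [ side-reducible q 0F , side-reducible q 1F ] (∨-split (saturatedOn (Quad.faces q) (Quad.apexes q) β cs 0F) sides)
    where
    side-reducible : ∀ q b → T (saturatedOn (Quad.faces q) (Quad.apexes q) β cs b) → Reducible β
    side-reducible q b side = via q (ListAll.map pushed-out (variantsOf-gain (lettersOn q β) b))
      where
      pushed-out : ∀ {ρ} → Gains (lettersOn q β) b ρ → Reducible (variant q β ρ)
      pushed-out {ρ} (j , πⱼ≢b , ρⱼ≡b) with saturatedOn-sound (Quad.faces q) (Quad.apexes q) β cs b side j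
      ... | inj₂ βⱼ≡b = ⊥-elim (πⱼ≢b (≡.trans (lookup-map j (lookup β) (Quad.faces q)) βⱼ≡b))
      ... | inj₁ six  = reducible-unbalanced (lookup (Quad.apexes q) j) b (variant q β ρ)
        (≡.subst (7 ℕ.≤_) (≡.sym (variant-gains-letter q β ρ j b ρⱼ≡b πⱼ≢b)) (s≤s (≡.subst (6 ℕ.≤_) (exact _ b) six)))

  reducible-hopeless : ∀ {n} (cols : Vec (Vec Bool 6) n) complete cs e₂s → Consistent cols complete cs e₂s →
    T (hopeless cs e₂s) → ∀ xs → 11 ℕ.≤ count 0F (complete xs) → Reducible (complete xs)
  reducible-hopeless cols complete cs e₂s consistent h xs heavy with ∨-split (9 <ᵇ e₂s) h
  ... | inj₁ too-many-e₂ = ⊥-elim (<-irrefl refl (≡.subst (21 ℕ.≤_) (count0F+count1F≡length (complete xs))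
                                 (+-mono-≤ heavy (≤-trans (<ᵇ⇒< 9 e₂s too-many-e₂)
                                   (≡.subst (e₂s ℕ.≤_) (proj₂ (consistent xs)) (m≤m+n e₂s _))))))
  ... | inj₂ sat = let v , b , 6<c = saturated-sound cs sat in
    reducible-unbalanced v b (complete xs)
      (≤-trans 6<c (≡.subst (letter b (lookup cs v) ℕ.≤_) (proj₁ (consistent xs) v b) (m≤m+n _ _)))

  reducible-search : ∀ {n} (cols : Vec (Vec Bool 6) n) qs complete cs e₂s → Consistent cols complete cs e₂s →
    search cols qs complete cs e₂s ≡ true → ∀ xs → 11 ℕ.≤ count 0F (complete xs) → Reducible (complete xs)
  reducible-search [] qs complete cs e₂s consistent h [] heavy
    with ∨-split (hopeless cs e₂s) (Equivalence.from T-≡ h)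
  ... | inj₁ hopeless! = reducible-hopeless [] complete cs e₂s consistent hopeless! [] heavy
  ... | inj₂ reducible = reducible-quadReducible qs (complete []) cs
                           (λ v b → ≡.trans (≡.sym (+-identityʳ _)) (proj₁ (consistent []) v b)) reducible
  reducible-search (col ∷ cols) qs complete cs e₂s consistent h (x ∷ xs) heavy
    with ∨-split (hopeless cs e₂s) (Equivalence.from T-≡ h)
  ... | inj₁ hopeless! = reducible-hopeless (col ∷ cols) complete cs e₂s consistent hopeless! (x ∷ xs) heavy
  ... | inj₂ both      = reducible-search cols qs (complete ∘ (x ∷_)) _ _
                           (consistent-bump col cols complete cs e₂s consistent x) (Equivalence.to T-≡ (branch x both)) xs heavy
    where
    branch : ∀ x → T (search cols qs (complete ∘ (0F ∷_)) (bumpWhere col 0F cs) e₂s ∧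
                      search cols qs (complete ∘ (1F ∷_)) (bumpWhere col 1F cs) (1 + e₂s)) →
             T (search cols qs (complete ∘ (x ∷_)) (bumpWhere col x cs) (occurs 1F x + e₂s))
    branch 0F = ∧-fst (search cols qs (complete ∘ (0F ∷_)) (bumpWhere col 0F cs) e₂s)
    branch 1F = ∧-snd (search cols qs (complete ∘ (0F ∷_)) (bumpWhere col 0F cs) e₂s)

  searchSucceeds : search columns quads id start 0 ≡ true
  searchSucceeds = refl

  reducible-heavy : ∀ β → 11 ℕ.≤ count 0F β → Reducible β
  reducible-heavy = reducible-search columns quads id start 0 consistent-start searchSucceeds

open Certificates

module Vanishing {c ℓ : Level} (R : CommutativeRing c ℓ) where

  open import Algebra.Properties.CommutativeSemigroup using ()
  open import Data.Bool using (Bool; T)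
  open import Data.Bool.ListAction using (all)
  open import Data.Bool.Properties using (T-≡)
  open import Data.Empty using (⊥-elim)
  open import Data.Fin using (zero; suc)
  open import Data.Fin.Patterns using (0F; 1F)
  open import Data.List using (List; []; _∷_; null)
  open import Data.List.Relation.Unary.All as ListAll using ()
  open import Data.List.Relation.Unary.All.Properties using (all⁺)
  open import Data.List.Relation.Unary.Any using (satisfied)
  open import Data.List.Relation.Unary.Any.Properties using (any⁻)
  open import Data.Nat as ℕ using (ℕ; _+_; s≤s)
  open import Data.Nat.Properties using (<ᵇ⇒<; ≤-trans; m≤m+n; ≤⇒≯; <-irrefl; +-mono-≤; +-identityʳ; +-comm)
  open import Data.Product using (_,_; proj₁; proj₂)
  open import Data.Sum using ([_,_]; inj₁; inj₂)
  open import Data.Vec using (Vec; []; _∷_; lookup; map; replicate; tabulate)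
  open import Data.Vec.Properties using (tabulate∘lookup; lookup-map; ∷-injective)
  open import Function using (_∘_; id; Equivalence)
  open import Level using (_⊔_)
  open import Relation.Binary.PropositionalEquality as ≡ using (_≡_; _≢_; refl; module ≡-Reasoning)


  open CommutativeRing R using (Carrier; _≈_; _*_; 1#; reflexive; semiring)
  open import Algebra.Properties.Semiring.Mult semiring using () renaming (_×_ to _·_)

  Vanishes : Word₆ → Set (c ⊔ ℓ)
  Vanishes β = VanishesInΛ R 6 (basis R β)

  vanishes-generator : ∀ (q : Quad) β u → VanishesInΛ R 6 (∏ R (fill (Quad.faces q) (replicate 4 u) (map (e R) β)))
  vanishes-generator q β u = vanishes-resp R (λ w → reflexive (simple≡∏ w)) (vanishes-simple R F degenerate)
    where
    open Quad q
    G : Vec (V₂ R) 20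
    G = fill faces (replicate 4 u) (map (e R) β)

    F : Family R 6
    F i j k = lookup G (position (i , j , k))

    faces-u : select (facesOf x y z t) G ≡ replicate 4 u
    faces-u = ≡.subst (λ s → select s G ≡ replicate 4 u) faces≡facesOf (select-fill faces-unique (replicate 4 u) _)

    same : ∀ {f g} → f ≡ u → g ≡ u → ∀ d → f d ≈ g d
    same f≡u g≡u d = reflexive (≡.cong (λ h → h d) (≡.trans f≡u (≡.sym g≡u)))

    degenerate : Degenerate R F
    degenerate with ∷-injective faces-u
    ... | xyz≡u , rest₁ with ∷-injective rest₁
    ...   | xyt≡u , rest₂ with ∷-injective rest₂
    ...     | xzt≡u , rest₃ with ∷-injective rest₃
    ...       | yzt≡u , _ = x , y , z , t , proj₁ increasing , proj₁ (proj₂ increasing) , proj₂ (proj₂ increasing) ,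
                            same xyz≡u xyt≡u , same xyt≡u xzt≡u , same xzt≡u yzt≡u

    simple≡∏ : ∀ w → simple R F w ≡ ∏ R G w
    simple≡∏ w = ≡.trans (prodOver≡∏ R F (triples 6) w)
                         (≡.cong (λ fs → ∏ R fs w) (map-≡-lookup {f = λ (i , j , k) → F i j k} {xs = triangles} {ys = G}
                           (λ p → ≡.cong (lookup G) (position∘triangle p))))

  module _ {six⁻¹ : Carrier} (six⁻¹-inverse : six⁻¹ * (6 · 1#) ≈ 1#) where

    vanishes-by-variants : ∀ q β → ListAll.All (Vanishes ∘ variant q β) (variants q β) → Vanishes β
    vanishes-by-variants q β =
      Symmetrisation.vanishes-by-variants R six⁻¹-inverse (Quad.faces-unique q) β (vanishes-generator q β)

    vanishes-reducible : ∀ {β} → Reducible β → Vanishes β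
    vanishes-variants : ∀ q {β} πs → ListAll.All (Reducible ∘ variant q β) πs → ListAll.All (Vanishes ∘ variant q β) πs
    vanishes-reducible (via q {β} reducible) = vanishes-by-variants q β (vanishes-variants q (variants q β) reducible)
    vanishes-variants q []       ListAll.[]       = ListAll.[]
    vanishes-variants q (π ∷ πs) (r ListAll.∷ rs) = vanishes-reducible r ListAll.∷ vanishes-variants q πs rs

module _ {c ℓ : Level} (R : CommutativeRing c ℓ) where

  open import Data.Product using (∃; _,_; proj₁; proj₂)
  open import Data.Vec using (map)
  open import Data.Vec.Properties using (map-∘)
  open import Relation.Binary.PropositionalEquality using (_≡_)
  open CommutativeRing R using (_≈_; _*_; _+_; 1#; semiring; *-commutativeSemigroup; *-comm; *-cong; *-congˡ;
    *-identityʳ; +-congˡ; +-identityʳ; +-assoc; sym; trans)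
  open import Algebra.Properties.Semiring.Mult semiring using (×1-homo-*) renaming (_×_ to _·_)
  open import Algebra.Properties.CommutativeSemigroup *-commutativeSemigroup using (interchange)
  open import Relation.Binary.Reasoning.Setoid (CommutativeRing.setoid R)

  basisTensor≡basis : ∀ b w → basisTensor R 6 b w ≡ basis R (wordOf b) w
  basisTensor≡basis b w = ≡.trans (prodOver≡∏ R (λ i j k → e R (b i j k)) (triples 6) w)
    (≡.cong (λ fs → ∏ R fs w) (map-∘ (e R) (λ (i , j , k) → b i j k) triangles))

  six-invertible : IsField R → CharNot2 R → CharNot3 R → ∃ λ six⁻¹ → six⁻¹ * (6 · 1#) ≈ 1#
  six-invertible (_ , inverse) char≠2 char≠3 = i₂ * i₃ , (begin
    i₂ * i₃ * (6 · 1#)               ≈⟨ *-congˡ (×1-homo-* 2 3) ⟩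
    i₂ * i₃ * ((2 · 1#) * (3 · 1#))  ≈⟨ interchange i₂ i₃ _ _ ⟩
    i₂ * (2 · 1#) * (i₃ * (3 · 1#))  ≈⟨ *-cong (cancel two (proj₂ inverse₂)) (cancel three (proj₂ inverse₃)) ⟩
    1# * 1#                          ≈⟨ *-identityʳ 1# ⟩
    1#                               ∎)
    where
    inverse₂ = inverse (1# + 1#) char≠2
    inverse₃ = inverse (1# + 1# + 1#) char≠3
    i₂ = proj₁ inverse₂
    i₃ = proj₁ inverse₃
    cancel : ∀ {i n x} → n ≈ x → x * i ≈ 1# → i * n ≈ 1#
    cancel {x = x} n≈x x*i≈1 = trans (*-congˡ n≈x) (trans (*-comm _ x) x*i≈1)
    two : 2 · 1# ≈ 1# + 1#
    two = +-congˡ (+-identityʳ 1#)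
    three : 3 · 1# ≈ 1# + 1# + 1#
    three = trans (+-congˡ (+-congˡ (+-identityʳ 1#))) (sym (+-assoc 1# 1# 1#))

corollary4p3 : {c ℓ : Level} (R : CommutativeRing c ℓ) →
    IsField R → Infinite R → CharNot2 R → CharNot3 R →
    (b : Fin 6 → Fin 6 → Fin 6 → Fin 2) →
    11 ≤ countE₁ b →
    VanishesInΛ R 6 (basisTensor R 6 b)
corollary4p3 R isField _ char≠2 char≠3 b heavy =
  vanishes-resp R (λ w → CommutativeRing.reflexive R (≡.sym (basisTensor≡basis R b w)))
    (Vanishing.vanishes-reducible R (proj₂ (six-invertible R isField char≠2 char≠3))
      (reducible-heavy (wordOf b) (≡.subst (11 ≤_) (countE₁≡count b) heavy)))
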